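{- Let $\mathcal{R}$ be a rewrite system on a set $\mathcal{F}$ of symbols and $t\in\mathcal{T}(\mathcal{F},\mathcal{X}\cup\mathcal{X}_A)$. For every ground instance $\alpha t$ of $t$ and every rewrite chain $\alpha t\rightarrow_{p_1,l_1\rightarrow r_1}t_1\rightarrow_{p_2,l_2\rightarrow r_2}t_2\rightarrow\cdots\rightarrow_{p_n,l_n\rightarrow r_n}t_n$ starting from $\alpha t$, we have $l_i\rightarrow r_i\in\mathcal{U}(t)$ for all $i\in[1..n]$.
   Context: $\mathcal{F}$ is a finite signature, $\mathcal{X}$ a set of variables, and $\mathcal{X}_A$ a set of "abstraction variables" disjoint from $\mathcal{X}$. A ground instance $\alpha t$ is obtained by a ground substitution $\alpha$ which, by convention, maps every abstraction variable to a ground term in $\mathcal{R}$-normal form (an irreducible ground term); rewrite steps $u\rightarrow_{p,l\rightarrow r}v$ are standard rewriting steps with rules of $\mathcal{R}$. For $f\in\mathcal{F}$, $Rls(f)=\{l\rightarrow r\in\mathcal{R}\mid \text{the top symbol of } l \text{ is } f\}$. The usable rules $\mathcal{U}(t)$ of $t\in\mathcal{T}(\mathcal{F},\mathcal{X}\cup\mathcal{X}_A)$ are defined by: $\mathcal{U}(t)=\mathcal{R}$ if $t\in\mathcal{X}$; $\mathcal{U}(t)=\emptyset$ if $t\in\mathcal{X}_A$; $\mathcal{U}(f(u_1,\ldots,u_n))=Rls(f)\cup\bigcup_{i=1}^n\mathcal{U}(u_i)\cup\bigcup_{l\rightarrow r\in Rls(f)}\mathcal{U}(r)$. -}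

module Defs where

open import Data.Nat using (ℕ)
open import Data.Fin using (Fin; _≟_)
open import Data.Maybe using (Maybe; just; nothing)
open import Data.Product using (Σ; ∃; _×_; _,_)
open import Data.Sum using (_⊎_; inj₁; inj₂)
open import Data.Empty using (⊥)
open import Data.List using (List; []; _∷_)
open import Relation.Nullary using (¬_; yes; no)
open import Relation.Binary.PropositionalEquality using (_≡_)

record Signature : Set where
  field
    size  : ℕ
    arity : Fin size → ℕ
open Signature public

data Term (S : Signature) (V : Set) : Set where
  var : V → Term S V
  app : (f : Fin (size S)) → (Fin (arity S f) → Term S V) → Term S V

module _ {S : Signature} where

  _⟪_⟫ : {V W : Set} → Term S V → (V → Term S W) → Term S W
  var x    ⟪ σ ⟫ = σ x
  app f ts ⟪ σ ⟫ = app f (λ i → ts i ⟪ σ ⟫)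

  rename : {V W : Set} → (V → W) → Term S V → Term S W
  rename ρ (var x)    = var (ρ x)
  rename ρ (app f ts) = app f (λ i → rename ρ (ts i))

  head : {V : Set} → Term S V → Maybe (Fin (size S))
  head (var _)   = nothing
  head (app f _) = just f

  data Occurs {V : Set} (x : V) : Term S V → Set where
    here  : Occurs x (var x)
    there : ∀ {f ts} (i : Fin (arity S f)) → Occurs x (ts i) → Occurs x (app f ts)

  update : {V : Set} {k : ℕ} → (Fin k → Term S V) → Fin k → Term S V → Fin k → Term S V
  update ts i u j with j ≟ i
  ... | yes _ = u
  ... | no  _ = ts j

record Rule (S : Signature) (X : Set) : Set where
  constructor _⇒_
  field
    lhs : Term S X
    rhs : Term S X
open Rule public

WellFormed : {S : Signature} {X : Set} → Rule S X → Set
WellFormed {S} {X} ρ =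
  (Σ (Fin (size S)) λ f → Σ (Fin (arity S f) → Term S X) λ ts → lhs ρ ≡ app f ts)
  × (∀ (x : X) → Occurs x (rhs ρ) → Occurs x (lhs ρ))

record TRS (S : Signature) (X : Set) : Set₁ where
  field
    rules : Rule S X → Set
    wf    : ∀ ρ → rules ρ → WellFormed ρ
open TRS public

_∈R_ : {S : Signature} {X : Set} → TRS S X → Rule S X → Set
R ∈R ρ = rules R ρ

module _ {S : Signature} {X : Set} where

  -- One rewrite step u →_{p, ρ} v (the position p is the path of `under`s).
  data Step (ρ : Rule S X) {V : Set} : Term S V → Term S V → Set where
    root  : (σ : X → Term S V) → Step ρ (lhs ρ ⟪ σ ⟫) (rhs ρ ⟪ σ ⟫)
    under : ∀ {f ts v} (i : Fin (arity S f)) → Step ρ (ts i) v →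
            Step ρ (app f ts) (app f (update ts i v))

  data Chain (R : TRS S X) {V : Set} : Term S V → Term S V → List (Rule S X) → Set where
    done : ∀ {u} → Chain R u u []
    step : ∀ {u v w ρ ρs} → (R ∈R ρ) → Step ρ u v → Chain R v w ρs → Chain R u w (ρ ∷ ρs)

  NormalForm : (R : TRS S X) {V : Set} → Term S V → Set
  NormalForm R {V} u = ¬ (Σ (Rule S X) λ ρ → Σ (Term S V) λ v → (R ∈R ρ) × Step ρ u v)

  Rls : TRS S X → Fin (size S) → Rule S X → Set
  Rls R f ρ = (R ∈R ρ) × (head (lhs ρ) ≡ just f)

  -- Usable rules U(t) for t ∈ T(F, X ∪ X_A) (least set satisfying the defining equations):
  -- membership  Usable R t ρ  means  ρ ∈ U(t).
  data Usable (R : TRS S X) {XA : Set} : Term S (X ⊎ XA) → Rule S X → Set where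
    u-var : ∀ {x ρ} → R ∈R ρ → Usable R (var (inj₁ x)) ρ
    u-rls : ∀ {f ts ρ} → Rls R f ρ → Usable R (app f ts) ρ
    u-arg : ∀ {f ts ρ} (i : Fin (arity S f)) → Usable R (ts i) ρ → Usable R (app f ts) ρ
    u-rhs : ∀ {f ts ρ ρ'} → Rls R f ρ' → Usable R (rename {W = X ⊎ XA} inj₁ (rhs ρ')) ρ →
            Usable R (app f ts) ρ

Ground : Signature → Set
Ground S = Term S ⊥

{-# OPTIONS --safe #-}
module Submission where

-- Every term u of the chain satisfies a syntactic invariant "U covers u", for
-- U = U(t): either U contains all of R, or u is R-normal, or u = f(us) where U contains Rls(f)
-- and the usable rules of the right-hand sides in Rls(f), and U covers every us i. It holds for
-- α t because abstraction variables are mapped to normal forms, and a step l σ → r σ at a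
-- covered redex uses a rule of Rls(f) ⊆ U and yields r σ, which is covered: the symbols of r
-- are handled by U(r) ⊆ U, and r's variables occur in l, so their values are covered subterms
-- of l σ.

open import Defs
open import Level using (0ℓ)
open import Data.Sum using (_⊎_; inj₁; inj₂)
open import Data.List using (List)
open import Data.List.Relation.Unary.All using (All; []; _∷_)
open import Data.Fin using (Fin; _≟_)
open import Data.Product using (_×_; _,_; proj₂)
open import Data.Empty using (⊥-elim)
open import Relation.Nullary using (yes; no)
open import Relation.Unary using (Pred; _⊆_)
open import Relation.Binary.PropositionalEquality using (refl)

module _ {S : Signature} where

  update-pointwise : ∀ {V} {k} (P : Pred (Term S V) 0ℓ) {ts : Fin k → Term S V} {v} (i : Fin k) →
                     (∀ j → P (ts j)) → P v → ∀ j → P (update ts i v j)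
  update-pointwise P i Pts Pv j with j ≟ i
  ... | yes _ = Pv
  ... | no  _ = Pts j

  NormalForm-arg : ∀ {X} {R : TRS S X} {V} {f} {ts : Fin (arity S f) → Term S V} (i : Fin (arity S f)) →
                   NormalForm R (app f ts) → NormalForm R (ts i)
  NormalForm-arg i nf (ρ , _ , ρ∈R , s) = nf (ρ , _ , ρ∈R , under i s)

module Covering {S : Signature} {X : Set} (R : TRS S X) (XA : Set) (U : Pred (Rule S X) 0ℓ) where

  UsableX : Term S X → Pred (Rule S X) 0ℓ
  UsableX s = Usable R {XA} (rename inj₁ s)

  HeadClosed : Fin (size S) → Set
  HeadClosed f = Rls R f ⊆ U × (∀ {ρ} → Rls R f ρ → UsableX (rhs ρ) ⊆ U)

  headClosed : ∀ {f} {ts : Fin (arity S f) → Term S (X ⊎ XA)} → Usable R (app f ts) ⊆ U → HeadClosed f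
  headClosed U⊇ = (λ ρ∈Rls → U⊇ (u-rls ρ∈Rls)) , (λ ρ∈Rls q → U⊇ (u-rhs ρ∈Rls q))

  data Covered : Ground S → Set where
    all-rules : ∀ {u} → rules R ⊆ U → Covered u
    normal    : ∀ {u} → NormalForm R u → Covered u
    node      : ∀ {f us} → HeadClosed f → (∀ i → Covered (us i)) → Covered (app f us)

  Covered-arg : ∀ {f us} (i : Fin (arity S f)) → Covered (app f us) → Covered (us i)
  Covered-arg _ (all-rules R⊆U)  = all-rules R⊆U
  Covered-arg i (normal nf)      = normal (NormalForm-arg {R = R} i nf)
  Covered-arg i (node _ covered) = covered i

  Covered-var : ∀ {x} {l : Term S X} {σ : X → Ground S} → Occurs x l → Covered (l ⟪ σ ⟫) → Covered (σ x)
  Covered-var here          c = c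
  Covered-var (there i occ) c = Covered-var occ (Covered-arg i c)

  Covered-instance : (s : Term S X) {σ : X → Ground S} → UsableX s ⊆ U →
                     (∀ x → Occurs x s → Covered (σ x)) → Covered (s ⟪ σ ⟫)
  Covered-instance (var x)    U⊇ covered = covered x here
  Covered-instance (app f ss) U⊇ covered =
    node (headClosed U⊇)
         (λ i → Covered-instance (ss i) (λ q → U⊇ (u-arg i q)) (λ x occ → covered x (there i occ)))

  root-preserves : ∀ {ρ} → R ∈R ρ → (σ : X → Ground S) → Covered (lhs ρ ⟪ σ ⟫) →
                   U ρ × Covered (rhs ρ ⟪ σ ⟫)
  root-preserves {var _ ⇒ _} ρ∈R _ _ with wf R _ ρ∈R
  ... | (_ , _ , ()) , _
  root-preserves {app _ _ ⇒ _} ρ∈R _ (all-rules R⊆U) = R⊆U ρ∈R , all-rules R⊆U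
  root-preserves {app _ _ ⇒ _} ρ∈R σ (normal nf)     = ⊥-elim (nf (_ , _ , ρ∈R , root σ))
  root-preserves {app _ _ ⇒ r} ρ∈R σ c@(node (Rls⊆U , rhs⊆U) _) =
    Rls⊆U (ρ∈R , refl) ,
    Covered-instance r (rhs⊆U (ρ∈R , refl)) (λ x occ → Covered-var (proj₂ (wf R _ ρ∈R) x occ) c)

  step-preserves : ∀ {ρ u v} → R ∈R ρ → Step ρ u v → Covered u → U ρ × Covered v
  step-preserves ρ∈R (root σ) c = root-preserves ρ∈R σ c
  step-preserves ρ∈R (under _ _) (all-rules R⊆U) = R⊆U ρ∈R , all-rules R⊆U
  step-preserves ρ∈R (under i s) (normal nf)     = ⊥-elim (nf (_ , _ , ρ∈R , under i s))
  step-preserves ρ∈R (under i s) (node hc covered) with step-preserves ρ∈R s (covered i)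
  ... | ρ∈U , cv = ρ∈U , node hc (update-pointwise Covered i covered cv)

  chain-rules⊆ : ∀ {u w ρs} → Chain R u w ρs → Covered u → All U ρs
  chain-rules⊆ done            _ = []
  chain-rules⊆ (step ρ∈R s ch) c with step-preserves ρ∈R s c
  ... | ρ∈U , cv = ρ∈U ∷ chain-rules⊆ ch cv

  Covered-ground-instance : {α : X ⊎ XA → Ground S} → (∀ a → NormalForm R (α (inj₂ a))) →
                            (s : Term S (X ⊎ XA)) → Usable R s ⊆ U → Covered (s ⟪ α ⟫)
  Covered-ground-instance α-normal (var (inj₁ x)) U⊇ = all-rules (λ ρ∈R → U⊇ (u-var ρ∈R))
  Covered-ground-instance α-normal (var (inj₂ a)) U⊇ = normal (α-normal a)
  Covered-ground-instance α-normal (app f ss)     U⊇ =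
    node (headClosed U⊇) (λ i → Covered-ground-instance α-normal (ss i) (λ q → U⊇ (u-arg i q)))

lemma6p2p2 : (S : Signature) (X XA : Set) (R : TRS S X) (t : Term S (X ⊎ XA))
    → (α : X ⊎ XA → Ground S)
    → (∀ (a : XA) → NormalForm R (α (inj₂ a)))
    → (w : Ground S) (ρs : List (Rule S X))
    → Chain R (t ⟪ α ⟫) w ρs
    → All (Usable R t) ρs
lemma6p2p2 S X XA R t α α-normal w ρs chain =
  chain-rules⊆ chain (Covered-ground-instance α-normal t (λ q → q))
  where open Covering R XA (Usable R t)
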